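{- Suppose that for all partitions $\lambda,\mu,\nu$ of the same size $n\ge1$, the coefficient $c^\lambda_{\mu,\nu}(b)$ (the case $k=1$) is a polynomial in $b$ with non-negative integer coefficients. Then for every $k\ge1$ and all $\lambda,\mu^0,\dots,\mu^k\vdash n\ge1$, $c^\lambda_{\mu^0,\dots,\mu^k}(b)$ is a polynomial in $b$ with non-negative integer coefficients.
   Context: $\alpha=1+b$; $J^{(\alpha)}_\theta$ are Jack symmetric functions (Macdonald's $J$-normalization, orthogonal for $\langle p_\lambda,p_\mu\rangle_\alpha=z_\lambda\alpha^{\ell(\lambda)}\delta_{\lambda\mu}$), $j^{(\alpha)}_\theta=\langle J_\theta,J_\theta\rangle_\alpha$, $z_\lambda=\prod_im_i(\lambda)!i^{m_i(\lambda)}$. For $k\ge1$ and power-sum variable sequences $\mathbf{p},\mathbf{q}^{(0)},\dots,\mathbf{q}^{(k)}$, $\tau^{(k)}_b=\sum_{n\ge0}t^n\sum_{\theta\vdash n}\frac{1}{j^{(\alpha)}_\theta}J_\theta(\mathbf{p})J_\theta(\mathbf{q}^{(0)})\cdots J_\theta(\mathbf{q}^{(k)})$, and $c^\lambda_{\mu^0,\dots,\mu^k}(b)$ are defined by $\tau^{(k)}_b=1+\sum_{n\ge1}t^n\sum_{\lambda,\mu^0,\dots,\mu^k\vdash n}\frac{c^\lambda_{\mu^0,\dots,\mu^k}(b)}{z_\lambda(1+b)^{\ell(\lambda)}}p_\lambda q^{(0)}_{\mu^0}\cdots q^{(k)}_{\mu^k}$. -}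

module Defs where

open import Data.Bool using (Bool; true; false; if_then_else_)
open import Data.Nat as ℕ using (ℕ; zero; suc; _∸_; _≤ᵇ_; _≡ᵇ_)
open import Data.Nat using (_!)
open import Data.List using (allFin; List; []; _∷_; _++_; map; concatMap; applyUpTo; filter; length; foldr; replicate; take)
open import Data.Fin as Fin using (Fin)
open import Data.Integer using (+_)
open import Data.Rational using (ℚ; 0ℚ; 1ℚ; _+_; _*_; _/_; 1/_; _≤_)
open import Data.Rational.Properties using (_≟_)
open import Data.Rational.Base using (≢-nonZero)
open import Relation.Nullary using (yes; no; ¬_)
open import Relation.Binary.PropositionalEquality using (_≡_; _≢_)
open import Data.List.Membership.Propositional using (_∈_)
open import Data.Product using (Σ; _×_)

-- Partitions: weakly decreasing lists of positive naturals.

-- partitions of n with all parts ≤ m (fuel f ≥ n)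
partsBounded : ℕ → ℕ → ℕ → List (List ℕ)
partsBounded f zero m = [] ∷ []
partsBounded zero (suc n) m = []
partsBounded (suc f) (suc n) m =
  concatMap (λ k → map (k ∷_) (partsBounded f (suc n ∸ k) k))
            (applyUpTo suc (ℕ._⊓_ (suc n) m))

partitions : ℕ → List (List ℕ)
partitions n = partsBounded n n n

ℕ→ℚ : ℕ → ℚ
ℕ→ℚ n = + n / 1

sumℚ : List ℚ → ℚ
sumℚ = foldr _+_ 0ℚ

prodℚ : List ℚ → ℚ
prodℚ = foldr _*_ 1ℚ

powℚ : ℚ → ℕ → ℚ
powℚ q zero = 1ℚ
powℚ q (suc n) = q * powℚ q n

-- totalised reciprocal (1/0 := 0); only ever applied to j_θ > 0
inv : ℚ → ℚ
inv q with q ≟ 0ℚ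
... | yes _ = 0ℚ
... | no ne = 1/_ q {{≢-nonZero ne}}

-- evaluation of a polynomial given by its coefficient list (constant first)
evalPoly : List ℕ → ℚ → ℚ
evalPoly [] b = 0ℚ
evalPoly (c ∷ cs) b = ℕ→ℚ c + b * evalPoly cs b

sumℕ : List ℕ → ℕ
sumℕ = foldr ℕ._+_ 0

prodℕ : List ℕ → ℕ
prodℕ = foldr ℕ._*_ 1

mult : ℕ → List ℕ → ℕ
mult i λ' = length (filter (λ x → i ℕ.≟ x) λ')

zee : List ℕ → ℕ
zee λ' = prodℕ (map (λ i → (mult i λ') ! ℕ.* (i ℕ.^ mult i λ')) (applyUpTo suc (sumℕ λ')))

choices : ℕ → List ℕ → List (List ℕ)
choices x [] = []
choices x (r ∷ rs) =
  (if x ≤ᵇ r then ((r ∸ x) ∷ rs) ∷ [] else []) ++ map (r ∷_) (choices x rs)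

allZero : List ℕ → Bool
allZero [] = true
allZero (r ∷ rs) = if r ≡ᵇ 0 then allZero rs else false

-- fill λ μ = number of maps f : {1..ℓ(λ)} → {1..ℓ(μ)} with
-- Σ_{f(j)=i} λ_j = μ_i for all i
fill : List ℕ → List ℕ → ℕ
fill [] rem = if allZero rem then 1 else 0
fill (x ∷ xs) rem = sumℕ (map (fill xs) (choices x rem))

-- R_{λμ}: coefficient of m_μ in p_λ  (p_λ = Σ_μ R_{λμ} m_μ)
R : List ℕ → List ℕ → ℕ
R λ' μ = fill λ' μ

_⊴_ : List ℕ → List ℕ → Set
μ ⊴ θ = ∀ i → sumℕ (take i μ) ℕ.≤ sumℕ (take i θ)

-- Jack symmetric functions J^{(α)}_θ, given by their power-sum
-- coefficients: J_θ = Σ_{λ ⊢ |θ|} A θ λ · p_λ.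

-- ⟨f , g⟩_α for f = Σ a_λ p_λ, g = Σ c_λ p_λ homogeneous of degree n
innerα : ℚ → ℕ → (List ℕ → ℚ) → (List ℕ → ℚ) → ℚ
innerα α n f g =
  sumℚ (map (λ λ' → ℕ→ℚ (zee λ') * powℚ α (length λ') * f λ' * g λ') (partitions n))

-- coefficient of m_μ in Σ_λ f λ p_λ (degree n)
mCoeff : ℕ → (List ℕ → ℚ) → List ℕ → ℚ
mCoeff n f μ = sumℚ (map (λ λ' → f λ' * ℕ→ℚ (R λ' μ)) (partitions n))

-- Macdonald's characterisation (J-normalisation) of the Jack functions:
-- (i) J_θ = Σ_{μ ⊴ θ} v_{θμ} m_μ, (ii) v_{θ,1^n} = n!, (iii) orthogonality.
record IsJack (α : ℚ) (A : List ℕ → List ℕ → ℚ) : Set where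
  field
    triangular : ∀ n θ μ → θ ∈ partitions n → μ ∈ partitions n →
                 ¬ (μ ⊴ θ) → mCoeff n (A θ) μ ≡ 0ℚ
    normalised : ∀ n θ → θ ∈ partitions n →
                 mCoeff n (A θ) (replicate n 1) ≡ ℕ→ℚ (n !)
    orthogonal : ∀ n θ η → θ ∈ partitions n → η ∈ partitions n →
                 θ ≢ η → innerα α n (A θ) (A η) ≡ 0ℚ

jnorm : ℚ → (List ℕ → List ℕ → ℚ) → ℕ → List ℕ → ℚ
jnorm α A n θ = innerα α n (A θ) (A θ)

-- c^λ_{μ^0,…,μ^k}(b), read off τ^{(k)}_b with α = 1 + b:
-- c = z_λ α^{ℓ(λ)} Σ_{θ ⊢ n} (1/j_θ) [p_λ]J_θ · ∏_i [p_{μ^i}]J_θ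
coeffC : (b : ℚ) → (List ℕ → List ℕ → ℚ) → (n k : ℕ) →
         List ℕ → (Fin (suc k) → List ℕ) → ℚ
coeffC b A n k λ' μs =
  ℕ→ℚ (zee λ') * powℚ (1ℚ + b) (length λ') *
  sumℚ (map (λ θ → inv (jnorm (1ℚ + b) A n θ) * A θ λ' *
                   prodℚ (map (λ i → A θ (μs i)) (allFin (suc k))))
            (partitions n))

pair : List ℕ → List ℕ → Fin 2 → List ℕ
pair μ ν Fin.zero = μ
pair μ ν (Fin.suc _) = ν

-- Orthogonality of the Jack functions gives ⟨Σ_η x_η J_η , J_θ⟩ = x_θ j_θ.  Inserting the
-- defining formula of c and summing over an intermediate partition ν therefore yields
-- c^λ_{μ^0 … μ^k} = Σ_ν c^ν_{μ^0 μ^1} c^λ_{ν μ^2 … μ^k}, so by induction on k every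
-- coefficient is a finite sum of products of coefficients with k = 1, and polynomials
-- with non-negative integer coefficients are closed under sums and products.
module Submission where

open import Defs
open import Data.Nat as ℕ using (ℕ; zero; suc; _∸_; _⊓_; _≥_)
open import Data.Nat.Properties using (<⇒≢; suc-injective)
open import Data.Fin as Fin using (Fin)
open import Data.List using (List; []; _∷_; _++_; map; length; applyUpTo; allFin; tabulate)
open import Data.List.Properties using (∷-injectiveˡ; ∷-injectiveʳ; map-∘)
open import Data.List.Membership.Propositional using (_∈_)
open import Data.List.Membership.Propositional.Properties using (∈-map⁻)
open import Data.List.Relation.Unary.Any using (here; there)
open import Data.List.Relation.Unary.All as All using (All; []; _∷_)
import Data.List.Relation.Unary.All.Properties as All
open import Data.List.Relation.Unary.AllPairs as AllPairs using ([]; _∷_)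
import Data.List.Relation.Unary.AllPairs.Properties as AllPairs
open import Data.List.Relation.Unary.Unique.Propositional using (Unique)
import Data.List.Relation.Unary.Unique.Propositional.Properties as Unique
open import Data.List.Relation.Binary.Disjoint.Propositional using (Disjoint)
import Data.Integer as ℤ
open import Data.Integer.Properties using (pos-+; pos-*)
import Data.Integer.Tactic.RingSolver as ℤ-Ring
open import Data.Rational using (ℚ; 0ℚ; 1ℚ; _+_; _*_; _≤_; toℚᵘ; 1/_)
open import Data.Rational.Properties
  using ( _≟_; toℚᵘ-injective; toℚᵘ-fromℚᵘ; toℚᵘ-homo-+; toℚᵘ-homo-*
        ; +-identityˡ; +-identityʳ; *-identityˡ; *-identityʳ; *-zeroˡ; *-zeroʳ; *-assoc
        ; *-inverseˡ; *-distribˡ-+; *-distribʳ-+)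
open import Data.Rational.Base using (≢-nonZero)
open import Data.Rational.Solver using (module +-*-Solver)
import Data.Rational.Unnormalised as ℚᵘ
import Data.Rational.Unnormalised.Properties as ℚᵘ
open import Data.Product using (Σ; _,_)
open import Function using (_∘_)
open import Relation.Binary.PropositionalEquality
open import Relation.Nullary using (yes; no)

map-∷-disjoint : ∀ {k k′ : ℕ} (xss yss : List (List ℕ)) → k ≢ k′ →
                 Disjoint (map (k ∷_) xss) (map (k′ ∷_) yss)
map-∷-disjoint xss yss k≢k′ (p , q) with ∈-map⁻ _ p | ∈-map⁻ _ q
... | _ , _ , refl | _ , _ , eq = k≢k′ (∷-injectiveˡ eq)

partsBounded-unique : ∀ f n m → Unique (partsBounded f n m)
partsBounded-unique f       zero    m = [] ∷ []
partsBounded-unique zero    (suc n) m = []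
partsBounded-unique (suc f) (suc n) m =
  Unique.concat⁺
    (All.map⁺ (All.universal (λ k → Unique.map⁺ ∷-injectiveʳ (partsBounded-unique f (suc n ∸ k) k)) firsts))
    (AllPairs.map⁺ (AllPairs.map (λ {k} {k′} k≢k′ {v} → map-∷-disjoint (blocks k) (blocks k′) k≢k′ {v})
                                 firsts-unique))
  where
  blocks : ℕ → List (List ℕ)
  blocks k = partsBounded f (suc n ∸ k) k
  firsts : List ℕ
  firsts = applyUpTo suc (suc n ⊓ m)
  firsts-unique : Unique firsts
  firsts-unique = Unique.applyUpTo⁺₁ suc _ (λ i<j _ → <⇒≢ i<j ∘ suc-injective)

partitions-unique : ∀ n → Unique (partitions n)
partitions-unique n = partsBounded-unique n n n

module _ {I : Set} where

  ∑ : List I → (I → ℚ) → ℚ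
  ∑ xs f = sumℚ (map f xs)

  ∑-cong : ∀ xs {f g : I → ℚ} → (∀ x → x ∈ xs → f x ≡ g x) → ∑ xs f ≡ ∑ xs g
  ∑-cong []       f≗g = refl
  ∑-cong (x ∷ xs) f≗g = cong₂ _+_ (f≗g x (here refl)) (∑-cong xs (λ y y∈ → f≗g y (there y∈)))

  ∑-zero : ∀ xs {f : I → ℚ} → (∀ x → x ∈ xs → f x ≡ 0ℚ) → ∑ xs f ≡ 0ℚ
  ∑-zero xs f≗0 = trans (∑-cong xs f≗0) (∑-const-0 xs)
    where
    ∑-const-0 : ∀ xs → ∑ xs (λ _ → 0ℚ) ≡ 0ℚ
    ∑-const-0 []       = refl
    ∑-const-0 (_ ∷ xs) = trans (+-identityˡ _) (∑-const-0 xs)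

  ∑-+ : ∀ xs (f g : I → ℚ) → ∑ xs (λ x → f x + g x) ≡ ∑ xs f + ∑ xs g
  ∑-+ []       f g = sym (+-identityˡ 0ℚ)
  ∑-+ (x ∷ xs) f g = trans (cong ((f x + g x) +_) (∑-+ xs f g))
    (solve 4 (λ a b c d → (a :+ b) :+ (c :+ d) := (a :+ c) :+ (b :+ d)) refl (f x) (g x) (∑ xs f) (∑ xs g))
    where open +-*-Solver

  *-distribˡ-∑ : ∀ c xs (f : I → ℚ) → c * ∑ xs f ≡ ∑ xs (λ x → c * f x)
  *-distribˡ-∑ c []       f = *-zeroʳ c
  *-distribˡ-∑ c (x ∷ xs) f = trans (*-distribˡ-+ c (f x) (∑ xs f)) (cong ((c * f x) +_) (*-distribˡ-∑ c xs f))

  *-distribʳ-∑ : ∀ c xs (f : I → ℚ) → ∑ xs f * c ≡ ∑ xs (λ x → f x * c)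
  *-distribʳ-∑ c []       f = *-zeroˡ c
  *-distribʳ-∑ c (x ∷ xs) f = trans (*-distribʳ-+ c (f x) (∑ xs f)) (cong ((f x * c) +_) (*-distribʳ-∑ c xs f))

  ∑-supported : ∀ xs {f : I → ℚ} {x} → Unique xs → x ∈ xs →
                (∀ y → y ∈ xs → y ≢ x → f y ≡ 0ℚ) → ∑ xs f ≡ f x
  ∑-supported (y ∷ ys) {f} (y∉ys ∷ _) (here refl) f-vanishes =
    trans (cong (f y +_) (∑-zero ys (λ z z∈ → f-vanishes z (there z∈) (λ { refl → All.lookup y∉ys z∈ refl }))))
          (+-identityʳ _)
  ∑-supported (y ∷ ys) (y∉ys ∷ ys-unique) (there x∈) f-vanishes =
    trans (cong₂ _+_ (f-vanishes y (here refl) (λ { refl → All.lookup y∉ys x∈ refl }))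
                     (∑-supported ys ys-unique x∈ (λ z z∈ → f-vanishes z (there z∈))))
          (+-identityˡ _)

∑-comm : ∀ {I K : Set} (xs : List I) (ys : List K) (f : I → K → ℚ) →
         ∑ xs (λ x → ∑ ys (f x)) ≡ ∑ ys (λ y → ∑ xs (λ x → f x y))
∑-comm []       ys f = sym (∑-zero ys (λ _ _ → refl))
∑-comm (x ∷ xs) ys f =
  trans (cong (∑ ys (f x) +_) (∑-comm xs ys f)) (sym (∑-+ ys (f x) (λ y → ∑ xs (λ x → f x y))))

prodℚ-map-++ : ∀ {I : Set} (f : I → ℚ) xs ys → prodℚ (map f (xs ++ ys)) ≡ prodℚ (map f xs) * prodℚ (map f ys)
prodℚ-map-++ f []       ys = sym (*-identityˡ _)
prodℚ-map-++ f (x ∷ xs) ys = trans (cong (f x *_) (prodℚ-map-++ f xs ys)) (sym (*-assoc (f x) _ _))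

-- Also valid for q = 0 (inv 0 = 0).
inv*inv*q≡inv : ∀ q → inv q * inv q * q ≡ inv q
inv*inv*q≡inv q with q ≟ 0ℚ
... | yes _  = trans (cong (_* q) (*-zeroˡ 0ℚ)) (*-zeroˡ q)
... | no q≢0 = trans (*-assoc q⁻¹ q⁻¹ q) (trans (cong (q⁻¹ *_) (*-inverseˡ q {{≢-nonZero q≢0}})) (*-identityʳ q⁻¹))
  where q⁻¹ = 1/_ q {{≢-nonZero q≢0}}

module OrthogonalFamily {I : Set} (basis : List I) (weight : I → ℚ) (J : I → I → ℚ) where

  ⟨_,_⟩ : I → I → ℚ
  ⟨ θ , η ⟩ = ∑ basis (λ ν → weight ν * J θ ν * J η ν)

  Π : I → List I → ℚ
  Π θ μs = prodℚ (map (J θ) μs)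

  structureCoeff : I → List I → ℚ
  structureCoeff λ′ μs = weight λ′ * ∑ basis (λ θ → inv ⟨ θ , θ ⟩ * J θ λ′ * Π θ μs)

  module _ (basis-unique : Unique basis)
           (orthogonal : ∀ θ η → θ ∈ basis → η ∈ basis → θ ≢ η → ⟨ θ , η ⟩ ≡ 0ℚ) where

    open +-*-Solver
    open ≡-Reasoning

    ⟨∑,⟩ : ∀ (x : I → ℚ) θ → θ ∈ basis →
           ∑ basis (λ ν → weight ν * ∑ basis (λ η → x η * J η ν) * J θ ν) ≡ x θ * ⟨ θ , θ ⟩
    ⟨∑,⟩ x θ θ∈ = begin
        ∑ basis (λ ν → weight ν * ∑ basis (λ η → x η * J η ν) * J θ ν)
      ≡⟨ ∑-cong basis (λ ν _ → expand ν) ⟩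
        ∑ basis (λ ν → ∑ basis (λ η → x η * (weight ν * J η ν * J θ ν)))
      ≡⟨ ∑-comm basis basis _ ⟩
        ∑ basis (λ η → ∑ basis (λ ν → x η * (weight ν * J η ν * J θ ν)))
      ≡⟨ ∑-cong basis (λ η _ → sym (*-distribˡ-∑ (x η) basis _)) ⟩
        ∑ basis (λ η → x η * ⟨ η , θ ⟩)
      ≡⟨ ∑-supported basis basis-unique θ∈
           (λ η η∈ η≢θ → trans (cong (x η *_) (orthogonal η θ η∈ θ∈ η≢θ)) (*-zeroʳ (x η))) ⟩
        x θ * ⟨ θ , θ ⟩ ∎
      where
      expand : ∀ ν → weight ν * ∑ basis (λ η → x η * J η ν) * J θ ν ≡
                     ∑ basis (λ η → x η * (weight ν * J η ν * J θ ν))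
      expand ν = begin
          weight ν * ∑ basis (λ η → x η * J η ν) * J θ ν
        ≡⟨ cong (_* J θ ν) (*-distribˡ-∑ (weight ν) basis _) ⟩
          ∑ basis (λ η → weight ν * (x η * J η ν)) * J θ ν
        ≡⟨ *-distribʳ-∑ (J θ ν) basis _ ⟩
          ∑ basis (λ η → weight ν * (x η * J η ν) * J θ ν)
        ≡⟨ ∑-cong basis (λ η _ → solve 4 (λ w a j t → w :* (a :* j) :* t := a :* (w :* j :* t)) refl
                                          (weight ν) (x η) (J η ν) (J θ ν)) ⟩
          ∑ basis (λ η → x η * (weight ν * J η ν * J θ ν)) ∎

    structureCoeff-pairing : ∀ μs θ → θ ∈ basis →
      ∑ basis (λ ν → structureCoeff ν μs * J θ ν) ≡ inv ⟨ θ , θ ⟩ * Π θ μs * ⟨ θ , θ ⟩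
    structureCoeff-pairing μs θ θ∈ = begin
        ∑ basis (λ ν → structureCoeff ν μs * J θ ν)
      ≡⟨ ∑-cong basis (λ ν _ → cong (λ s → weight ν * s * J θ ν) (∑-cong basis (λ η _ →
           solve 3 (λ w j p → w :* j :* p := w :* p :* j) refl (inv ⟨ η , η ⟩) (J η ν) (Π η μs)))) ⟩
        ∑ basis (λ ν → weight ν * ∑ basis (λ η → inv ⟨ η , η ⟩ * Π η μs * J η ν) * J θ ν)
      ≡⟨ ⟨∑,⟩ (λ η → inv ⟨ η , η ⟩ * Π η μs) θ θ∈ ⟩
        inv ⟨ θ , θ ⟩ * Π θ μs * ⟨ θ , θ ⟩ ∎

    structureCoeff-fusion : ∀ λ′ μs νs →
      structureCoeff λ′ (μs ++ νs) ≡ ∑ basis (λ ν → structureCoeff ν μs * structureCoeff λ′ (ν ∷ νs))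
    structureCoeff-fusion λ′ μs νs = sym (begin
        ∑ basis (λ ν → structureCoeff ν μs * structureCoeff λ′ (ν ∷ νs))
      ≡⟨ ∑-cong basis (λ ν _ → distribute ν) ⟩
        ∑ basis (λ ν → ∑ basis (λ θ → K θ * (structureCoeff ν μs * J θ ν)))
      ≡⟨ ∑-comm basis basis _ ⟩
        ∑ basis (λ θ → ∑ basis (λ ν → K θ * (structureCoeff ν μs * J θ ν)))
      ≡⟨ ∑-cong basis (λ θ θ∈ → trans (sym (*-distribˡ-∑ (K θ) basis _))
                                      (cong (K θ *_) (structureCoeff-pairing μs θ θ∈))) ⟩
        ∑ basis (λ θ → K θ * (w θ * Π θ μs * ⟨ θ , θ ⟩))
      ≡⟨ ∑-cong basis (λ θ _ → cancel θ) ⟩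
        ∑ basis (λ θ → weight λ′ * (w θ * J θ λ′ * Π θ (μs ++ νs)))
      ≡⟨ sym (*-distribˡ-∑ (weight λ′) basis _) ⟩
        structureCoeff λ′ (μs ++ νs) ∎)
      where
      w : I → ℚ
      w θ = inv ⟨ θ , θ ⟩
      K : I → ℚ
      K θ = weight λ′ * (w θ * J θ λ′ * Π θ νs)
      distribute : ∀ ν → structureCoeff ν μs * structureCoeff λ′ (ν ∷ νs) ≡
                         ∑ basis (λ θ → K θ * (structureCoeff ν μs * J θ ν))
      distribute ν = begin
          c * (weight λ′ * ∑ basis (λ θ → w θ * J θ λ′ * (J θ ν * Π θ νs)))
        ≡⟨ cong (c *_) (*-distribˡ-∑ (weight λ′) basis _) ⟩
          c * ∑ basis (λ θ → weight λ′ * (w θ * J θ λ′ * (J θ ν * Π θ νs)))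
        ≡⟨ *-distribˡ-∑ c basis _ ⟩
          ∑ basis (λ θ → c * (weight λ′ * (w θ * J θ λ′ * (J θ ν * Π θ νs))))
        ≡⟨ ∑-cong basis (λ θ _ →
             solve 6 (λ c a i l t p → c :* (a :* (i :* l :* (t :* p))) := a :* (i :* l :* p) :* (c :* t)) refl
                     c (weight λ′) (w θ) (J θ λ′) (J θ ν) (Π θ νs)) ⟩
          ∑ basis (λ θ → K θ * (c * J θ ν)) ∎
        where c = structureCoeff ν μs
      cancel : ∀ θ → K θ * (w θ * Π θ μs * ⟨ θ , θ ⟩) ≡ weight λ′ * (w θ * J θ λ′ * Π θ (μs ++ νs))
      cancel θ = begin
          K θ * (w θ * Π θ μs * ⟨ θ , θ ⟩)
        ≡⟨ solve 6 (λ a i l p q j → a :* (i :* l :* q) :* (i :* p :* j) := i :* i :* j :* (a :* (l :* (p :* q)))) refl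
                   (weight λ′) (w θ) (J θ λ′) (Π θ μs) (Π θ νs) ⟨ θ , θ ⟩ ⟩
          w θ * w θ * ⟨ θ , θ ⟩ * (weight λ′ * (J θ λ′ * (Π θ μs * Π θ νs)))
        ≡⟨ cong (_* (weight λ′ * (J θ λ′ * (Π θ μs * Π θ νs)))) (inv*inv*q≡inv ⟨ θ , θ ⟩) ⟩
          w θ * (weight λ′ * (J θ λ′ * (Π θ μs * Π θ νs)))
        ≡⟨ solve 5 (λ a i l p q → i :* (a :* (l :* (p :* q))) := a :* (i :* l :* (p :* q))) refl
                   (weight λ′) (w θ) (J θ λ′) (Π θ μs) (Π θ νs) ⟩
          weight λ′ * (w θ * J θ λ′ * (Π θ μs * Π θ νs))
        ≡⟨ cong (λ p → weight λ′ * (w θ * J θ λ′ * p)) (sym (prodℚ-map-++ (J θ) μs νs)) ⟩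
          weight λ′ * (w θ * J θ λ′ * Π θ (μs ++ νs)) ∎

toℚᵘ-ℕ→ℚ : ∀ n → toℚᵘ (ℕ→ℚ n) ℚᵘ.≃ ℚᵘ.mkℚᵘ (ℤ.+ n) 0
toℚᵘ-ℕ→ℚ n = toℚᵘ-fromℚᵘ (ℚᵘ.mkℚᵘ (ℤ.+ n) 0)

ℕ→ℚ-+ : ∀ m n → ℕ→ℚ (m ℕ.+ n) ≡ ℕ→ℚ m + ℕ→ℚ n
ℕ→ℚ-+ m n = toℚᵘ-injective (begin
  toℚᵘ (ℕ→ℚ (m ℕ.+ n))                           ≈⟨ toℚᵘ-ℕ→ℚ (m ℕ.+ n) ⟩
  ℚᵘ.mkℚᵘ (ℤ.+ (m ℕ.+ n)) 0                       ≈⟨ ℚᵘ.*≡* (trans (cong (ℤ._* ℤ.+ 1) (pos-+ m n))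
                                                                 (cross-multiplied (ℤ.+ m) (ℤ.+ n))) ⟩
  ℚᵘ.mkℚᵘ (ℤ.+ m) 0 ℚᵘ.+ ℚᵘ.mkℚᵘ (ℤ.+ n) 0         ≈⟨ ℚᵘ.+-cong (toℚᵘ-ℕ→ℚ m) (toℚᵘ-ℕ→ℚ n) ⟨
  toℚᵘ (ℕ→ℚ m) ℚᵘ.+ toℚᵘ (ℕ→ℚ n)                 ≈⟨ toℚᵘ-homo-+ (ℕ→ℚ m) (ℕ→ℚ n) ⟨
  toℚᵘ (ℕ→ℚ m + ℕ→ℚ n)                           ∎)
  where
  open ℚᵘ.≃-Reasoning
  cross-multiplied : ∀ x y → (x ℤ.+ y) ℤ.* ℤ.+ 1 ≡ (x ℤ.* ℤ.+ 1 ℤ.+ y ℤ.* ℤ.+ 1) ℤ.* ℤ.+ 1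
  cross-multiplied = ℤ-Ring.solve-∀

ℕ→ℚ-* : ∀ m n → ℕ→ℚ (m ℕ.* n) ≡ ℕ→ℚ m * ℕ→ℚ n
ℕ→ℚ-* m n = toℚᵘ-injective (begin
  toℚᵘ (ℕ→ℚ (m ℕ.* n))                           ≈⟨ toℚᵘ-ℕ→ℚ (m ℕ.* n) ⟩
  ℚᵘ.mkℚᵘ (ℤ.+ (m ℕ.* n)) 0                       ≈⟨ ℚᵘ.*≡* (cong (ℤ._* ℤ.+ 1) (pos-* m n)) ⟩
  ℚᵘ.mkℚᵘ (ℤ.+ m) 0 ℚᵘ.* ℚᵘ.mkℚᵘ (ℤ.+ n) 0         ≈⟨ ℚᵘ.*-cong (toℚᵘ-ℕ→ℚ m) (toℚᵘ-ℕ→ℚ n) ⟨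
  toℚᵘ (ℕ→ℚ m) ℚᵘ.* toℚᵘ (ℕ→ℚ n)                 ≈⟨ toℚᵘ-homo-* (ℕ→ℚ m) (ℕ→ℚ n) ⟨
  toℚᵘ (ℕ→ℚ m * ℕ→ℚ n)                           ∎)
  where open ℚᵘ.≃-Reasoning

infixl 6 _+ₚ_
infixl 7 _*ₚ_

_+ₚ_ : List ℕ → List ℕ → List ℕ
[]       +ₚ qs       = qs
(p ∷ ps) +ₚ []       = p ∷ ps
(p ∷ ps) +ₚ (q ∷ qs) = p ℕ.+ q ∷ ps +ₚ qs

_*ₚ_ : List ℕ → List ℕ → List ℕ
[]       *ₚ qs = []
(p ∷ ps) *ₚ qs = map (p ℕ.*_) qs +ₚ (0 ∷ ps *ₚ qs)

module _ where
  open +-*-Solver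

  evalPoly-+ₚ : ∀ ps qs b → evalPoly (ps +ₚ qs) b ≡ evalPoly ps b + evalPoly qs b
  evalPoly-+ₚ []       qs       b = sym (+-identityˡ _)
  evalPoly-+ₚ (p ∷ ps) []       b = sym (+-identityʳ _)
  evalPoly-+ₚ (p ∷ ps) (q ∷ qs) b =
    trans (cong₂ (λ c r → c + b * r) (ℕ→ℚ-+ p q) (evalPoly-+ₚ ps qs b))
          (solve 5 (λ P Q B X Y → P :+ Q :+ B :* (X :+ Y) := P :+ B :* X :+ (Q :+ B :* Y)) refl
                 (ℕ→ℚ p) (ℕ→ℚ q) b (evalPoly ps b) (evalPoly qs b))

  evalPoly-scale : ∀ a qs b → evalPoly (map (a ℕ.*_) qs) b ≡ ℕ→ℚ a * evalPoly qs b
  evalPoly-scale a []       b = sym (*-zeroʳ (ℕ→ℚ a))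
  evalPoly-scale a (q ∷ qs) b =
    trans (cong₂ (λ c r → c + b * r) (ℕ→ℚ-* a q) (evalPoly-scale a qs b))
          (solve 4 (λ A Q B Y → A :* Q :+ B :* (A :* Y) := A :* (Q :+ B :* Y)) refl
                 (ℕ→ℚ a) (ℕ→ℚ q) b (evalPoly qs b))

  evalPoly-*ₚ : ∀ ps qs b → evalPoly (ps *ₚ qs) b ≡ evalPoly ps b * evalPoly qs b
  evalPoly-*ₚ []       qs b = sym (*-zeroˡ (evalPoly qs b))
  evalPoly-*ₚ (p ∷ ps) qs b = begin
      evalPoly (map (p ℕ.*_) qs +ₚ (0 ∷ ps *ₚ qs)) b
    ≡⟨ evalPoly-+ₚ (map (p ℕ.*_) qs) (0 ∷ ps *ₚ qs) b ⟩
      evalPoly (map (p ℕ.*_) qs) b + (0ℚ + b * evalPoly (ps *ₚ qs) b)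
    ≡⟨ cong₂ _+_ (evalPoly-scale p qs b) (trans (+-identityˡ _) (cong (b *_) (evalPoly-*ₚ ps qs b))) ⟩
      ℕ→ℚ p * evalPoly qs b + b * (evalPoly ps b * evalPoly qs b)
    ≡⟨ solve 4 (λ P Y B X → P :* Y :+ B :* (X :* Y) := (P :+ B :* X) :* Y) refl
             (ℕ→ℚ p) (evalPoly qs b) b (evalPoly ps b) ⟩
      (ℕ→ℚ p + b * evalPoly ps b) * evalPoly qs b ∎
    where open ≡-Reasoning

IsℕPolynomial : (ℚ → ℚ) → Set
IsℕPolynomial f = Σ (List ℕ) (λ P → (b : ℚ) → 0ℚ ≤ b → f b ≡ evalPoly P b)

IsℕPolynomial-cong : ∀ {f g} → (∀ b → 0ℚ ≤ b → g b ≡ f b) → IsℕPolynomial f → IsℕPolynomial g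
IsℕPolynomial-cong g≗f (P , f≗P) = P , λ b b≥0 → trans (g≗f b b≥0) (f≗P b b≥0)

IsℕPolynomial-* : ∀ {f g} → IsℕPolynomial f → IsℕPolynomial g → IsℕPolynomial (λ b → f b * g b)
IsℕPolynomial-* (P , f≗P) (Q , g≗Q) =
  P *ₚ Q , λ b b≥0 → trans (cong₂ _*_ (f≗P b b≥0) (g≗Q b b≥0)) (sym (evalPoly-*ₚ P Q b))

IsℕPolynomial-∑ : ∀ {I : Set} (xs : List I) {F : ℚ → I → ℚ} →
                  (∀ x → x ∈ xs → IsℕPolynomial (λ b → F b x)) → IsℕPolynomial (λ b → ∑ xs (F b))
IsℕPolynomial-∑ []       Fx-poly = [] , λ _ _ → refl
IsℕPolynomial-∑ (x ∷ xs) Fx-poly with Fx-poly x (here refl) | IsℕPolynomial-∑ xs (λ y y∈ → Fx-poly y (there y∈))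
... | P , Fx≗P | Q , rest≗Q =
  P +ₚ Q , λ b b≥0 → trans (cong₂ _+_ (Fx≗P b b≥0) (rest≗Q b b≥0)) (sym (evalPoly-+ₚ P Q b))

jackWeight : ℚ → List ℕ → ℚ
jackWeight α ν = ℕ→ℚ (zee ν) * powℚ α (length ν)

module JackCoefficients (A : ℚ → List ℕ → List ℕ → ℚ) (n : ℕ) where

  module Jack (b : ℚ) = OrthogonalFamily (partitions n) (jackWeight (1ℚ + b)) (A b)

  c : ℚ → List ℕ → List (List ℕ) → ℚ
  c b = Jack.structureCoeff b

  coeffC≡c : ∀ b k λ′ (μs : Fin (suc k) → List ℕ) →
             coeffC b (A b) n k λ′ μs ≡ c b λ′ (map μs (allFin (suc k)))
  coeffC≡c b k λ′ μs =
    cong (jackWeight (1ℚ + b) λ′ *_) (∑-cong (partitions n) (λ θ _ →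
      cong (inv (jnorm (1ℚ + b) (A b) n θ) * A b θ λ′ *_) (cong prodℚ (map-∘ {g = A b θ} {f = μs} (allFin (suc k))))))

  module _ (jack : (b : ℚ) → 0ℚ ≤ b → IsJack (1ℚ + b) (A b))
           (base : ∀ λ′ μ ν → λ′ ∈ partitions n → μ ∈ partitions n → ν ∈ partitions n →
                   IsℕPolynomial (λ b → coeffC b (A b) n 1 λ′ (pair μ ν))) where

    c-isℕPolynomial : ∀ μ ν ρs → μ ∈ partitions n → ν ∈ partitions n → All (_∈ partitions n) ρs →
                      ∀ λ′ → λ′ ∈ partitions n → IsℕPolynomial (λ b → c b λ′ (μ ∷ ν ∷ ρs))
    c-isℕPolynomial μ ν [] μ∈ ν∈ [] λ′ λ′∈ =
      IsℕPolynomial-cong (λ b _ → sym (coeffC≡c b 1 λ′ (pair μ ν))) (base λ′ μ ν λ′∈ μ∈ ν∈)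
    c-isℕPolynomial μ ν (ρ ∷ ρs) μ∈ ν∈ (ρ∈ ∷ ρs∈) λ′ λ′∈ =
      IsℕPolynomial-cong
        (λ b b≥0 → Jack.structureCoeff-fusion b (partitions-unique n) (IsJack.orthogonal (jack b b≥0) n)
                     λ′ (μ ∷ ν ∷ []) (ρ ∷ ρs))
        (IsℕPolynomial-∑ (partitions n) (λ κ κ∈ →
          IsℕPolynomial-* (c-isℕPolynomial μ ν [] μ∈ ν∈ [] κ κ∈) (c-isℕPolynomial κ ρ ρs κ∈ ρ∈ ρs∈ λ′ λ′∈)))

corollary6p2 :
    (A : ℚ → List ℕ → List ℕ → ℚ) →
    ((b : ℚ) → 0ℚ ≤ b → IsJack (1ℚ + b) (A b)) →
    ((n : ℕ) → n ≥ 1 → (λ' μ ν : List ℕ) →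
       λ' ∈ partitions n → μ ∈ partitions n → ν ∈ partitions n →
       Σ (List ℕ) (λ P → (b : ℚ) → 0ℚ ≤ b →
         coeffC b (A b) n 1 λ' (pair μ ν) ≡ evalPoly P b)) →
    (k : ℕ) → k ≥ 1 → (n : ℕ) → n ≥ 1 → (λ' : List ℕ) → (μs : Fin (suc k) → List ℕ) →
    λ' ∈ partitions n → ((i : Fin (suc k)) → μs i ∈ partitions n) →
    Σ (List ℕ) (λ P → (b : ℚ) → 0ℚ ≤ b → coeffC b (A b) n k λ' μs ≡ evalPoly P b)
corollary6p2 A jack base zero () n n≥1 λ′ μs λ′∈ μs∈
-- map μs (allFin (2 + k)) unfolds to μs 0 ∷ μs 1 ∷ map μs (tabulate (suc ∘ suc)).
corollary6p2 A jack base (suc k) _ n n≥1 λ′ μs λ′∈ μs∈ =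
  IsℕPolynomial-cong (λ b _ → coeffC≡c b (suc k) λ′ μs)
    (c-isℕPolynomial jack (base n n≥1) (μs Fin.zero) (μs (Fin.suc Fin.zero)) (map μs (tabulate (Fin.suc ∘ Fin.suc)))
       (μs∈ Fin.zero) (μs∈ (Fin.suc Fin.zero)) (All.map⁺ (All.universal μs∈ _)) λ′ λ′∈)
  where open JackCoefficients A n
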